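{- Fix a surjection $f:\mathbb N\to\mathbf v_2$, and define $\sigma_1:W\to\mathcal P(\mathbb N)$ and $\sigma_2:W\to\{0,1\}$ by $\sigma_1(A,B,C)=\{n\in\mathbb N: f(n)\in A\}$ and $\sigma_2(A,B,C)=1$ if $\mathbf w\trianglelefteq(A,B,C)$ and $\mathbf w\neq(A,B,C)$, and $\sigma_2(A,B,C)=0$ otherwise. Then $\sigma_1,\sigma_2$ are monotone with respect to $\trianglelefteq$, hence also with respect to $\prec_1$ and $\prec_2$. Moreover, letting $\mathcal M_1'$ be the expansion of $\mathcal M_1$ by a unary predicate $R$ with $V(R,w)=\sigma_1(w)$, and $\mathcal M_2'$ the expansion of $\mathcal M_2$ by a propositional letter $S$ true at $w$ iff $\sigma_2(w)=1$, we have $\mathcal M_1',\mathbf v\models\forall x\exists y(P(y)\wedge(Q(y)\to R(x)))\wedge\neg\forall xR(x)$ and $\mathcal M_2',\mathbf w\not\models\forall x(P(x)\to(Q(x)\vee S))\to S$.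
   Context: $\mathbb N=\{1,2,3,\dots\}$. A quasi-partition is a triple $(A,B,C)$ of pairwise disjoint subsets of $\mathbb N$ with $A\cup B\cup C=\mathbb N$, $A,C$ infinite, $B$ empty or infinite; $W$ is the set of all quasi-partitions. $(A,B,C)\trianglelefteq(D,E,F)$ iff $A\subseteq D$ and $F\subseteq C$. $\mathbf v=(\mathbf v_1,\mathbf v_2,\mathbf v_3)$ with $\mathbf v_r=\{n\in\mathbb N:n\equiv r-1\pmod3\}$; $\mathbf w=(\mathbf w_1,\emptyset,\mathbf w_3)$ with $\mathbf w_1$ the even and $\mathbf w_3$ the odd elements of $\mathbb N$. $\mathcal M_i=(W,\prec_i,\mathbb N,V_i)$ ($i=1,2$) are Kripke models with constant domain $\mathbb N$ for unary $P,Q$: $\prec_2=\trianglelefteq$; $(A,B,C)\prec_1(D,E,F)$ iff $(A,B,C)\trianglelefteq(D,E,F)$ and [if $\mathbf v\trianglelefteq(A,B,C)$ and $B\cap\mathbf v_2$ infinite then $E\cap\mathbf v_2$ infinite]; $V_i(P,(A,B,C))=A\cup B$, $V_i(Q,(A,B,C))=A$. Semantics: $u\models P(n)$ iff $n\in V(P,u)$; $\wedge,\vee$ pointwise; $u\models\alpha\to\beta$ iff every $u'$ with $u\prec u'$ has $u'\not\models\alpha$ or $u'\models\beta$; $\neg\alpha:=\alpha\to\bot$; $\forall,\exists$ range over $\mathbb N$. -}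

module Defs where

open import Level using (Level; Lift; lift) renaming (suc to lsuc; zero to lzero)
open import Data.Nat using (ℕ; zero; suc; _+_; _*_; _<_; _≤_; s≤s)
open import Data.Nat.Properties using (≤-trans; m≤n+m; m≤m*n)
open import Data.Nat.DivMod using (_%_; [m+kn]%n≡m%n; m%n<n)
open import Data.Product using (Σ; ∃; _×_; _,_; proj₁; proj₂)
open import Data.Sum using (_⊎_; inj₁; inj₂)
open import Data.Empty using (⊥)
open import Relation.Nullary using (¬_)
open import Relation.Binary.PropositionalEquality using (_≡_; refl; sym; trans)

-- The paper's ℕ = {1,2,3,...}: the positive naturals.
-- An element  1+ k  denotes the positive number  k + 1.

record ℕ⁺ : Set where
  constructor 1+_
  field pred : ℕ

val : ℕ⁺ → ℕ
val (1+ k) = suc k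

Subset : Set₁
Subset = ℕ⁺ → Set

_⊆_ : Subset → Subset → Set
X ⊆ Y = ∀ n → X n → Y n

_≐_ : Subset → Subset → Set
X ≐ Y = (X ⊆ Y) × (Y ⊆ X)

_∩_ : Subset → Subset → Subset
(X ∩ Y) n = X n × Y n

∅ : Subset
∅ _ = ⊥

Empty : Subset → Set
Empty X = ∀ n → ¬ X n

Infinite : Subset → Set
Infinite X = ∀ (m : ℕ) → ∃ λ n → m < val n × X n

Disjoint : Subset → Subset → Set
Disjoint X Y = ∀ n → ¬ (X n × Y n)

record Triple : Set₁ where
  constructor ⟨_,_,_⟩
  field
    fst snd thd : Subset
open Triple public

IsQP : Triple → Set
IsQP ⟨ A , B , C ⟩ =
  Disjoint A B × Disjoint A C × Disjoint B C ×
  (∀ n → A n ⊎ B n ⊎ C n) ×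
  Infinite A × Infinite C × (Empty B ⊎ Infinite B)

W : Set₁
W = Σ Triple IsQP

𝔸 𝔹 ℂ : W → Subset
𝔸 u = fst (proj₁ u)
𝔹 u = snd (proj₁ u)
ℂ u = thd (proj₁ u)

_⊴_ : W → W → Set
u ⊴ u' = (𝔸 u ⊆ 𝔸 u') × (ℂ u' ⊆ ℂ u)

_≈W_ : W → W → Set
u ≈W u' = (𝔸 u ≐ 𝔸 u') × (𝔹 u ≐ 𝔹 u') × (ℂ u ≐ ℂ u')

𝐯₁ 𝐯₂ 𝐯₃ : Subset
𝐯₁ n = val n % 3 ≡ 0
𝐯₂ n = val n % 3 ≡ 1
𝐯₃ n = val n % 3 ≡ 2

𝐰₁ 𝐰₃ : Subset
𝐰₁ n = val n % 2 ≡ 0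
𝐰₃ n = val n % 2 ≡ 1

private
  0≢1 : ¬ (0 ≡ 1)
  0≢1 ()
  0≢2 : ¬ (0 ≡ 2)
  0≢2 ()
  1≢2 : ¬ (1 ≡ 2)
  1≢2 ()

  cover3 : ∀ n → 𝐯₁ n ⊎ 𝐯₂ n ⊎ 𝐯₃ n
  cover3 n with val n % 3 | m%n<n (val n) 3
  ... | 0 | _ = inj₁ refl
  ... | 1 | _ = inj₂ (inj₁ refl)
  ... | 2 | _ = inj₂ (inj₂ refl)
  ... | suc (suc (suc _)) | s≤s (s≤s (s≤s ()))

  cover2 : ∀ n → 𝐰₁ n ⊎ ∅ n ⊎ 𝐰₃ n
  cover2 n with val n % 2 | m%n<n (val n) 2
  ... | 0 | _ = inj₁ refl
  ... | 1 | _ = inj₂ (inj₂ refl)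
  ... | suc (suc _) | s≤s (s≤s ())

  inf-v₁ : Infinite 𝐯₁
  inf-v₁ m = 1+ (2 + m * 3)
           , s≤s (≤-trans (m≤m*n m 3) (m≤n+m (m * 3) 2))
           , [m+kn]%n≡m%n 0 (suc m) 3

  inf-v₂ : Infinite 𝐯₂
  inf-v₂ m = 1+ (m * 3) , s≤s (m≤m*n m 3) , [m+kn]%n≡m%n 1 m 3

  inf-v₃ : Infinite 𝐯₃
  inf-v₃ m = 1+ (1 + m * 3)
           , s≤s (≤-trans (m≤m*n m 3) (m≤n+m (m * 3) 1))
           , [m+kn]%n≡m%n 2 m 3

  inf-w₁ : Infinite 𝐰₁
  inf-w₁ m = 1+ (1 + m * 2)
           , s≤s (≤-trans (m≤m*n m 2) (m≤n+m (m * 2) 1))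
           , [m+kn]%n≡m%n 0 (suc m) 2

  inf-w₃ : Infinite 𝐰₃
  inf-w₃ m = 1+ (m * 2) , s≤s (m≤m*n m 2) , [m+kn]%n≡m%n 1 m 2

𝐯 : W
𝐯 = ⟨ 𝐯₁ , 𝐯₂ , 𝐯₃ ⟩
  , (λ n p → 0≢1 (trans (sym (proj₁ p)) (proj₂ p)))
  , (λ n p → 0≢2 (trans (sym (proj₁ p)) (proj₂ p)))
  , (λ n p → 1≢2 (trans (sym (proj₁ p)) (proj₂ p)))
  , cover3 , inf-v₁ , inf-v₃ , inj₂ inf-v₂

𝐰 : W
𝐰 = ⟨ 𝐰₁ , ∅ , 𝐰₃ ⟩
  , (λ n p → proj₂ p)
  , (λ n p → 0≢1 (trans (sym (proj₁ p)) (proj₂ p)))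
  , (λ n p → proj₁ p)
  , cover2 , inf-w₁ , inf-w₃ , inj₁ (λ n ())

_≺₂_ : W → W → Set
_≺₂_ = _⊴_

_≺₁_ : W → W → Set
u ≺₁ u' = (u ⊴ u') × ((𝐯 ⊴ u × Infinite (𝔹 u ∩ 𝐯₂)) → Infinite (𝔹 u' ∩ 𝐯₂))

record KModel : Set₂ where
  field
    World : Set₁
    _≺_   : World → World → Set
    VP VQ VR : World → Subset
    VS    : World → Set
open KModel public

data Formula : Set where
  P Q R : ℕ⁺ → Formula
  S     : Formula
  ⊥'    : Formula
  _∧'_ _∨'_ _⇒_ : Formula → Formula → Formula
  ∀' ∃' : (ℕ⁺ → Formula) → Formula

infixr 6 _∧'_
infixr 5 _∨'_
infixr 4 _⇒_

¬' : Formula → Formula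
¬' α = α ⇒ ⊥'

_,_⊩_ : (M : KModel) → World M → Formula → Set₁
M , u ⊩ P n = Lift (lsuc lzero) (VP M u n)
M , u ⊩ Q n = Lift (lsuc lzero) (VQ M u n)
M , u ⊩ R n = Lift (lsuc lzero) (VR M u n)
M , u ⊩ S = Lift (lsuc lzero) (VS M u)
M , u ⊩ ⊥' = Lift (lsuc lzero) ⊥
M , u ⊩ (α ∧' β) = (M , u ⊩ α) × (M , u ⊩ β)
M , u ⊩ (α ∨' β) = (M , u ⊩ α) ⊎ (M , u ⊩ β)
M , u ⊩ (α ⇒ β) = ∀ u' → _≺_ M u u' → M , u' ⊩ α → M , u' ⊩ β
M , u ⊩ ∀' φ = ∀ n → M , u ⊩ φ n
M , u ⊩ ∃' φ = ∃ λ n → M , u ⊩ φ n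

σ₁ : (ℕ⁺ → ℕ⁺) → W → Subset
σ₁ f u n = 𝔸 u (f n)

σ₂≡1 : W → Set
σ₂≡1 u = (𝐰 ⊴ u) × ¬ (𝐰 ≈W u)

-- M₁' : M₁ expanded by R with V(R,u) = σ₁(u)  (S is not in its language;
-- it is given the empty valuation and does not occur in the formula)
M₁' : (ℕ⁺ → ℕ⁺) → KModel
M₁' f = record { World = W ; _≺_ = _≺₁_
               ; VP = λ u → λ n → 𝔸 u n ⊎ 𝔹 u n ; VQ = 𝔸
               ; VR = σ₁ f ; VS = λ _ → ⊥ }

-- M₂' : M₂ expanded by S, true at u iff σ₂(u) = 1  (R not in its language)
M₂' : KModel
M₂' = record { World = W ; _≺_ = _≺₂_
             ; VP = λ u → λ n → 𝔸 u n ⊎ 𝔹 u n ; VQ = 𝔸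
             ; VR = λ _ _ → ⊥ ; VS = σ₂≡1 }

φ₁ : Formula
φ₁ = ∀' (λ x → ∃' (λ y → P y ∧' (Q y ⇒ R x))) ∧' ¬' (∀' (λ x → R x))

φ₂ : Formula
φ₂ = ∀' (λ x → P x ⇒ (Q x ∨' S)) ⇒ S

-- σ₁ and σ₂ are read off the first and third components, which only grow
-- resp. shrink along ⊴; the subtle point for σ₂ is that ⊴ is antisymmetric up
-- to ≈W, since the middle component is the complement of the other two.
-- At 𝐯, R(x) is forced at a successor exactly when f(x) lies in its first
-- component, and by the extra clause of ≺₁ every successor of 𝐯 has a point of
-- 𝐯₂ in its middle component, which surjectivity of f turns into a failure of
-- ∀x R(x). At 𝐰 the antecedent of φ₂ holds, because any successor with a
-- nonempty middle component differs from 𝐰 and so satisfies S, but S fails at 𝐰.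
module Submission where

open import Defs
open import Data.Product using (_×_; ∃; _,_; proj₁; proj₂)
open import Data.Sum using (_⊎_; inj₁; inj₂)
open import Data.Empty using (⊥-elim)
open import Level using (lift; lower)
open import Function using (_∘_)
open import Relation.Nullary using (¬_)
open import Relation.Binary.PropositionalEquality using (_≡_; refl; subst)

𝔸𝔹-disjoint : (u : W) → Disjoint (𝔸 u) (𝔹 u)
𝔸𝔹-disjoint (_ , d , _) = d

𝔹ℂ-disjoint : (u : W) → Disjoint (𝔹 u) (ℂ u)
𝔹ℂ-disjoint (_ , _ , _ , d , _) = d

covers : (u : W) → ∀ n → 𝔸 u n ⊎ 𝔹 u n ⊎ ℂ u n
covers (_ , _ , _ , _ , c , _) = c

𝔹-empty-or-infinite : (u : W) → Empty (𝔹 u) ⊎ Infinite (𝔹 u)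
𝔹-empty-or-infinite (_ , _ , _ , _ , _ , _ , _ , e) = e

⊆-refl : ∀ {X} → X ⊆ X
⊆-refl _ x = x

≐-refl : ∀ {X} → X ≐ X
≐-refl = ⊆-refl , ⊆-refl

⊴-refl : ∀ u → u ⊴ u
⊴-refl _ = ⊆-refl , ⊆-refl

⊴-trans : ∀ u u' u'' → u ⊴ u' → u' ⊴ u'' → u ⊴ u''
⊴-trans _ _ _ (a , c) (a' , c') = (λ n x → a' n (a n x)) , (λ n x → c n (c' n x))

≈W-refl : ∀ u → u ≈W u
≈W-refl _ = ≐-refl , ≐-refl , ≐-refl

≈W⇒⊵ : ∀ u u' → u ≈W u' → u' ⊴ u
≈W⇒⊵ _ _ ((_ , A'⊆A) , _ , (C⊆C' , _)) = A'⊆A , C⊆C'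

𝔹-⊆-of-⊴-⊵ : ∀ u u' → u ⊴ u' → u' ⊴ u → 𝔹 u ⊆ 𝔹 u'
𝔹-⊆-of-⊴-⊵ u u' (_ , C'⊆C) (A'⊆A , _) n b with covers u' n
... | inj₁ a'          = ⊥-elim (𝔸𝔹-disjoint u n (A'⊆A n a' , b))
... | inj₂ (inj₁ b')   = b'
... | inj₂ (inj₂ c')   = ⊥-elim (𝔹ℂ-disjoint u n (b , C'⊆C n c'))

⊴-antisym : ∀ u u' → u ⊴ u' → u' ⊴ u → u ≈W u'
⊴-antisym u u' u⊴u'@(A⊆A' , C'⊆C) u'⊴u@(A'⊆A , C⊆C') =
  (A⊆A' , A'⊆A) , (𝔹-⊆-of-⊴-⊵ u u' u⊴u' u'⊴u , 𝔹-⊆-of-⊴-⊵ u' u u'⊴u u⊴u') , (C⊆C' , C'⊆C)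

σ₁-monotone : (f : ℕ⁺ → ℕ⁺) → ∀ u u' → u ⊴ u' → σ₁ f u ⊆ σ₁ f u'
σ₁-monotone f u u' (A⊆A' , _) n = A⊆A' (f n)

σ₂-monotone : ∀ u u' → u ⊴ u' → σ₂≡1 u → σ₂≡1 u'
σ₂-monotone u u' u⊴u' (𝐰⊴u , 𝐰≉u) =
  ⊴-trans 𝐰 u u' 𝐰⊴u u⊴u' ,
  λ 𝐰≈u' → 𝐰≉u (⊴-antisym 𝐰 u 𝐰⊴u (⊴-trans u u' 𝐰 u⊴u' (≈W⇒⊵ 𝐰 u' 𝐰≈u')))

-- The clause Empty ⊎ Infinite of 𝐯 can only be the second one, as 1 ∈ 𝐯₂.
𝐯₂-infinite : Infinite 𝐯₂
𝐯₂-infinite with 𝔹-empty-or-infinite 𝐯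
... | inj₁ empty = ⊥-elim (empty (1+ 0) refl)
... | inj₂ inf   = inf

𝐯≺₁⇒𝔹∩𝐯₂-inhabited : ∀ u → 𝐯 ≺₁ u → ∃ λ m → 𝔹 u m × 𝐯₂ m
𝐯≺₁⇒𝔹∩𝐯₂-inhabited u (_ , grows) =
  let (m , _ , bv) = grows (⊴-refl 𝐯 , λ k → let (n , lt , v) = 𝐯₂-infinite k in n , lt , v , v) 0
  in m , bv

σ₁-full⇒𝐯₂⊆𝔸 : (f : ℕ⁺ → ℕ⁺) → (∀ m → 𝐯₂ m → ∃ λ n → f n ≡ m) →
  ∀ u → (∀ n → σ₁ f u n) → 𝐯₂ ⊆ 𝔸 u
σ₁-full⇒𝐯₂⊆𝔸 f onto u full m v with onto m v
... | n , refl = full n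

𝐯⊩∀∃ : (f : ℕ⁺ → ℕ⁺) → (∀ n → 𝐯₂ (f n)) →
  M₁' f , 𝐯 ⊩ ∀' (λ x → ∃' (λ y → P y ∧' (Q y ⇒ R x)))
𝐯⊩∀∃ f into x = f x , lift (inj₂ (into x)) , λ _ _ q → q

𝐯⊩¬∀R : (f : ℕ⁺ → ℕ⁺) → (∀ m → 𝐯₂ m → ∃ λ n → f n ≡ m) →
  M₁' f , 𝐯 ⊩ ¬' (∀' (λ x → R x))
𝐯⊩¬∀R f onto u 𝐯≺₁u allR =
  let (m , b , v) = 𝐯≺₁⇒𝔹∩𝐯₂-inhabited u 𝐯≺₁u
  in lift (𝔸𝔹-disjoint u m (σ₁-full⇒𝐯₂⊆𝔸 f onto u (λ n → lower (allR n)) m v , b))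

𝔹-inhabited⇒≉𝐰 : ∀ u n → 𝔹 u n → ¬ (𝐰 ≈W u)
𝔹-inhabited⇒≉𝐰 u n b (_ , (_ , 𝔹u⊆∅) , _) = 𝔹u⊆∅ n b

𝐰⊩∀P⇒Q∨S : M₂' , 𝐰 ⊩ ∀' (λ x → P x ⇒ (Q x ∨' S))
𝐰⊩∀P⇒Q∨S x u _  (lift (inj₁ a)) = inj₁ (lift a)
𝐰⊩∀P⇒Q∨S x u 𝐰⊴u (lift (inj₂ b)) = inj₂ (lift (𝐰⊴u , 𝔹-inhabited⇒≉𝐰 u x b))

𝐰⊮φ₂ : ¬ (M₂' , 𝐰 ⊩ φ₂)
𝐰⊮φ₂ 𝐰⊩φ₂ = proj₂ (lower (𝐰⊩φ₂ 𝐰 (⊴-refl 𝐰) 𝐰⊩∀P⇒Q∨S)) (≈W-refl 𝐰)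

lemma5 : (f : ℕ⁺ → ℕ⁺) → (∀ n → 𝐯₂ (f n)) → (∀ m → 𝐯₂ m → ∃ λ n → f n ≡ m) →
    ((∀ u u' → u ⊴ u' → σ₁ f u ⊆ σ₁ f u') ×
     (∀ u u' → u ⊴ u' → σ₂≡1 u → σ₂≡1 u') ×
     (∀ u u' → u ≺₁ u' → σ₁ f u ⊆ σ₁ f u') ×
     (∀ u u' → u ≺₁ u' → σ₂≡1 u → σ₂≡1 u') ×
     (∀ u u' → u ≺₂ u' → σ₁ f u ⊆ σ₁ f u') ×
     (∀ u u' → u ≺₂ u' → σ₂≡1 u → σ₂≡1 u')) ×
    (M₁' f , 𝐯 ⊩ φ₁) ×
    ¬ (M₂' , 𝐰 ⊩ φ₂)
lemma5 f into onto =
  ( σ₁-monotone f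
  , σ₂-monotone
  , (λ u u' → σ₁-monotone f u u' ∘ proj₁)
  , (λ u u' → σ₂-monotone u u' ∘ proj₁)
  , σ₁-monotone f
  , σ₂-monotone ) ,
  (𝐯⊩∀∃ f into , 𝐯⊩¬∀R f onto) ,
  𝐰⊮φ₂
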